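{- Let $G$ be a non-solvable group having an element of order $pq$, where $p,q$ are primes with $p\neq q$. Then $\Gamma_{sc}(G)$ has girth $3$, and hence $\Gamma_{sc}(G)$ is not a tree.
   Context: For a group $G$, the SCC-graph $\Gamma_{sc}(G)$ is the simple undirected graph whose vertices are the nontrivial conjugacy classes $x^G=\{gxg^{ -1}:g\in G\}$, $x\ne1$, of $G$, where two distinct vertices $x^G,y^G$ are adjacent if there exist $x'\in x^G$, $y'\in y^G$ with $\langle x',y'\rangle$ solvable. The girth of a graph is the length of a shortest cycle. -}

module Defs where

open import Level using (Level; _⊔_; Lift)
open import Algebra.Bundles using (Group)
open import Data.Nat using (ℕ; zero; suc; _≤_; _<_; _*_)
open import Data.Nat.Primality using (Prime)
open import Data.Fin using (Fin; inject₁; fromℕ) renaming (zero to fzero; suc to fsuc)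
open import Data.Product using (Σ; ∃; _×_; _,_)
open import Data.Sum using (_⊎_)
open import Data.Unit.Polymorphic using (⊤)
open import Relation.Nullary using (¬_)
open import Relation.Binary.PropositionalEquality using (_≡_)

module GroupTheory {c ℓ : Level} (G : Group c ℓ) where
  open Group G

  Pred : Set (Level.suc (c ⊔ ℓ))
  Pred = Carrier → Set (c ⊔ ℓ)

  data Gen (S : Pred) : Carrier → Set (c ⊔ ℓ) where
    gen  : ∀ {x} → S x → Gen S x
    unit : Gen S ε
    mul  : ∀ {x y} → Gen S x → Gen S y → Gen S (x ∙ y)
    inv  : ∀ {x} → Gen S x → Gen S (x ⁻¹)
    resp : ∀ {x y} → x ≈ y → Gen S x → Gen S y

  [_,_] : Carrier → Carrier → Carrier
  [ a , b ] = a ⁻¹ ∙ b ⁻¹ ∙ a ∙ b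

  Derived : ℕ → Pred → Pred
  Derived zero    H = H
  Derived (suc n) H = Gen (λ z → ∃ λ a → ∃ λ b →
                        Derived n H a × Derived n H b × z ≈ [ a , b ])

  SolvableSub : Pred → Set (c ⊔ ℓ)
  SolvableSub H = ∃ λ n → ∀ z → Derived n H z → z ≈ ε

  Solvable : Set (c ⊔ ℓ)
  Solvable = SolvableSub (λ _ → ⊤)

  ⟨_,_⟩ : Carrier → Carrier → Pred
  ⟨ x , y ⟩ = Gen (λ z → Lift c ((z ≈ x) ⊎ (z ≈ y)))

  _^_ : Carrier → ℕ → Carrier
  x ^ zero  = ε
  x ^ suc n = x ∙ (x ^ n)

  HasOrder : Carrier → ℕ → Set ℓ
  HasOrder x n = (0 < n) × (x ^ n ≈ ε) × (∀ k → 0 < k → k < n → ¬ (x ^ k ≈ ε))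

  Conj : Carrier → Carrier → Set (c ⊔ ℓ)
  Conj x y = ∃ λ g → y ≈ g ∙ x ∙ g ⁻¹

  -- SCC-graph. Vertices are nontrivial conjugacy classes, represented by
  -- elements x with x ≉ ε; two representatives give the same vertex iff
  -- they are conjugate.
  IsVertex : Carrier → Set ℓ
  IsVertex x = ¬ (x ≈ ε)

  Adj : Carrier → Carrier → Set (c ⊔ ℓ)
  Adj x y = ¬ Conj x y × (∃ λ x' → ∃ λ y' → Conj x x' × Conj y y' × SolvableSub ⟨ x' , y' ⟩)

  -- a cycle of length suc m (≥ 3) : pairwise distinct vertices v 0 … v m,
  -- consecutive ones adjacent and v m adjacent to v 0
  record Cycle (m : ℕ) : Set (c ⊔ ℓ) where
    field
      long     : 2 ≤ m
      v        : Fin (suc m) → Carrier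
      vertex   : ∀ i → IsVertex (v i)
      distinct : ∀ i j → ¬ (i ≡ j) → ¬ Conj (v i) (v j)
      step     : ∀ (i : Fin m) → Adj (v (inject₁ i)) (v (fsuc i))
      close    : Adj (v (fromℕ m)) (v fzero)

  HasGirth : ℕ → Set (c ⊔ ℓ)
  HasGirth g = (∃ λ m → suc m ≡ g × Cycle m) × (∀ m → Cycle m → g ≤ suc m)

  Acyclic : Set (c ⊔ ℓ)
  Acyclic = ∀ m → ¬ Cycle m

  data Walk : Carrier → Carrier → Set (c ⊔ ℓ) where
    here : ∀ {x y} → Conj x y → Walk x y
    next : ∀ {x y z} → Adj x y → Walk y z → Walk x z

  Connected : Set (c ⊔ ℓ)
  Connected = ∀ x y → IsVertex x → IsVertex y → Walk x y

  IsTree : Set (c ⊔ ℓ)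
  IsTree = Connected × Acyclic

-- The element x of order pq and its powers x^p, x^q lie in the abelian group ⟨x⟩,
-- so any two of them generate an abelian, hence solvable, subgroup. Conjugate
-- elements are annihilated by the same exponents; q kills x^p but neither x nor x^q,
-- and p kills x^q but not x, so the three classes are distinct and form a triangle.
module Submission where

open import Defs
open import Level using (Level; _⊔_; Lift; lift)
open import Algebra.Bundles using (Group)
open import Data.Nat using (ℕ; zero; suc; _+_; _*_; _%_; _/_; _<_; s≤s; z≤n; NonZero; >-nonZero; nonTrivial⇒n>1; nonTrivial⇒≢1)
open import Data.Nat.Properties using (+-comm; *-comm; m<m*n; <-trans; n≢0⇒n>0; _≟_)
open import Data.Nat.DivMod using (m≡m%n+[m/n]*n; m%n<n)
open import Data.Nat.Divisibility using (_∣_; m%n≡0⇒n∣m; m*n∣⇒m∣)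
open import Data.Nat.Primality using (Prime; prime⇒nonZero; prime⇒nonTrivial; euclidsLemma; prime⇒irreducible)
open import Data.Fin using (Fin) renaming (zero to fzero; suc to fsuc)
open import Data.Product using (∃; _×_; _,_; proj₁; proj₂)
open import Data.Sum using (_⊎_; inj₁; inj₂; [_,_]′; reduce)
open import Data.Empty using (⊥-elim)
open import Relation.Nullary using (¬_)
open import Relation.Nullary.Decidable using (decidable-stable)
open import Relation.Binary.PropositionalEquality using (_≡_)
import Relation.Binary.PropositionalEquality as ≡

distinctPrimes⇒¬p*q∣q*q : ∀ {p q} → Prime p → Prime q → ¬ p ≡ q → ¬ p * q ∣ q * q
distinctPrimes⇒¬p*q∣q*q {p} {q} pp pq p≢q pq∣qq =
  [ nonTrivial⇒≢1 {{prime⇒nonTrivial pp}} , p≢q ]′ (prime⇒irreducible pq p∣q)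
  where
  p∣q : p ∣ q
  p∣q = reduce (euclidsLemma q q pp (m*n∣⇒m∣ p q pq∣qq))

module GroupProperties {c ℓ : Level} (G : Group c ℓ) where
  open Group G
  open GroupTheory G
  open import Algebra.Properties.Group G using (ε⁻¹≈ε; x∙y⁻¹≈ε⇒x≈y; ∙-cancelˡ)
  open import Algebra.Properties.Monoid.Mult monoid using (×-homo-+; ×-assocˡ) renaming (_×_ to _·_)
  open import Relation.Binary.Reasoning.Setoid setoid

  ^≡· : ∀ x n → x ^ n ≡ n · x
  ^≡· x zero    = ≡.refl
  ^≡· x (suc n) = ≡.cong (x ∙_) (^≡· x n)

  ^-homo-+ : ∀ x m n → x ^ (m + n) ≈ x ^ m ∙ x ^ n
  ^-homo-+ x m n rewrite ^≡· x (m + n) | ^≡· x m | ^≡· x n = ×-homo-+ x m n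

  ^-assoc : ∀ x m n → (x ^ m) ^ n ≈ x ^ (n * m)
  ^-assoc x m n rewrite ^≡· (x ^ m) n | ^≡· x m | ^≡· x (n * m) = ×-assocˡ x n m

  ^-identityʳ : ∀ x → x ^ 1 ≈ x
  ^-identityʳ = identityʳ

  ε-^ : ∀ n → ε ^ n ≈ ε
  ε-^ zero    = refl
  ε-^ (suc n) = trans (identityˡ _) (ε-^ n)

  ^-cong : ∀ {x y} n → x ≈ y → x ^ n ≈ y ^ n
  ^-cong zero    x≈y = refl
  ^-cong (suc n) x≈y = ∙-cong x≈y (^-cong n x≈y)

  ^-%ⁿ : ∀ {x n} .{{_ : NonZero n}} → x ^ n ≈ ε → ∀ k → x ^ k ≈ x ^ (k % n)
  ^-%ⁿ {x} {n} xⁿ≈ε k = begin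
    x ^ k                             ≡⟨ ≡.cong (x ^_) (m≡m%n+[m/n]*n k n) ⟩
    x ^ (k % n + k / n * n)           ≈⟨ ^-homo-+ x (k % n) (k / n * n) ⟩
    x ^ (k % n) ∙ x ^ (k / n * n)     ≈⟨ ∙-congˡ (^-assoc x n (k / n)) ⟨
    x ^ (k % n) ∙ (x ^ n) ^ (k / n)   ≈⟨ ∙-congˡ (^-cong (k / n) xⁿ≈ε) ⟩
    x ^ (k % n) ∙ ε ^ (k / n)         ≈⟨ ∙-congˡ (ε-^ (k / n)) ⟩
    x ^ (k % n) ∙ ε                   ≈⟨ identityʳ _ ⟩
    x ^ (k % n)                       ∎

  order∣ : ∀ {x n k} → HasOrder x n → x ^ k ≈ ε → n ∣ k
  order∣ {x} {n} {k} (n>0 , xⁿ≈ε , minimal) xᵏ≈ε = m%n≡0⇒n∣m k n k%n≡0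
    where
    instance
      n≢0 : NonZero n
      n≢0 = >-nonZero n>0
    k%n≡0 : k % n ≡ 0
    k%n≡0 = decidable-stable (k % n ≟ 0) λ k%n≢0 →
      minimal (k % n) (n≢0⇒n>0 k%n≢0) (m%n<n k n) (trans (sym (^-%ⁿ xⁿ≈ε k)) xᵏ≈ε)

  Conj-^ : ∀ {x y g} → y ≈ g ∙ x ∙ g ⁻¹ → ∀ k → y ^ k ≈ g ∙ x ^ k ∙ g ⁻¹
  Conj-^ {g = g} y≈gxg⁻¹ zero = sym (trans (∙-congʳ (identityʳ g)) (inverseʳ g))
  Conj-^ {x} {y} {g} y≈gxg⁻¹ (suc k) = begin
    y ∙ y ^ k                                ≈⟨ ∙-cong y≈gxg⁻¹ (Conj-^ y≈gxg⁻¹ k) ⟩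
    (g ∙ x ∙ g ⁻¹) ∙ (g ∙ x ^ k ∙ g ⁻¹)      ≈⟨ assoc (g ∙ x) (g ⁻¹) _ ⟩
    g ∙ x ∙ (g ⁻¹ ∙ (g ∙ x ^ k ∙ g ⁻¹))      ≈⟨ ∙-congˡ (assoc (g ⁻¹) (g ∙ x ^ k) (g ⁻¹)) ⟨
    g ∙ x ∙ (g ⁻¹ ∙ (g ∙ x ^ k) ∙ g ⁻¹)      ≈⟨ ∙-congˡ (∙-congʳ (assoc (g ⁻¹) g (x ^ k))) ⟨
    g ∙ x ∙ ((g ⁻¹ ∙ g) ∙ x ^ k ∙ g ⁻¹)      ≈⟨ ∙-congˡ (∙-congʳ (trans (∙-congʳ (inverseˡ g)) (identityˡ _))) ⟩
    g ∙ x ∙ (x ^ k ∙ g ⁻¹)                   ≈⟨ assoc (g ∙ x) (x ^ k) (g ⁻¹) ⟨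
    g ∙ x ∙ x ^ k ∙ g ⁻¹                     ≈⟨ ∙-congʳ (assoc g x (x ^ k)) ⟩
    g ∙ (x ∙ x ^ k) ∙ g ⁻¹                   ∎

  Conj-preserves-^≈ε : ∀ {x y} → Conj x y → ∀ k → x ^ k ≈ ε → y ^ k ≈ ε
  Conj-preserves-^≈ε {x} (g , y≈gxg⁻¹) k xᵏ≈ε = begin
    _                ≈⟨ Conj-^ y≈gxg⁻¹ k ⟩
    g ∙ x ^ k ∙ g ⁻¹  ≈⟨ ∙-congʳ (trans (∙-congˡ xᵏ≈ε) (identityʳ g)) ⟩
    g ∙ g ⁻¹          ≈⟨ inverseʳ g ⟩
    ε                 ∎

  Conj-reflects-^≈ε : ∀ {x y} → Conj x y → ∀ k → y ^ k ≈ ε → x ^ k ≈ ε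
  Conj-reflects-^≈ε {x} (g , y≈gxg⁻¹) k yᵏ≈ε = ∙-cancelˡ g (x ^ k) ε
    (trans (x∙y⁻¹≈ε⇒x≈y (g ∙ x ^ k) g (trans (sym (Conj-^ y≈gxg⁻¹ k)) yᵏ≈ε)) (sym (identityʳ g)))

  Separated : Carrier → Carrier → Set (c ⊔ ℓ)
  Separated x y = ¬ Conj x y × ¬ Conj y x

  annihilator⇒Separated : ∀ {x y} k → x ^ k ≈ ε → ¬ y ^ k ≈ ε → Separated x y
  annihilator⇒Separated k xᵏ≈ε yᵏ≉ε =
    (λ x~y → yᵏ≉ε (Conj-preserves-^≈ε x~y k xᵏ≈ε)) , (λ y~x → yᵏ≉ε (Conj-reflects-^≈ε y~x k xᵏ≈ε))

  Gen-minimal : ∀ {p} {S : Pred} (P : Carrier → Set p) → (∀ {z} → S z → P z) → P ε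
    → (∀ {x y} → P x → P y → P (x ∙ y)) → (∀ {x} → P x → P (x ⁻¹))
    → (∀ {x y} → x ≈ y → P x → P y) → ∀ {z} → Gen S z → P z
  Gen-minimal P S⊆P P-ε P-∙ P-⁻¹ P-resp = go
    where
    go : ∀ {z} → Gen _ z → P z
    go (gen s)       = S⊆P s
    go unit          = P-ε
    go (mul gx gy)   = P-∙ (go gx) (go gy)
    go (inv gx)      = P-⁻¹ (go gx)
    go (resp x≈y gx) = P-resp x≈y (go gx)

  Gen-trivial : ∀ {S : Pred} → (∀ {z} → S z → z ≈ ε) → ∀ {z} → Gen S z → z ≈ ε
  Gen-trivial S-trivial = Gen-minimal (_≈ ε) S-trivial refl
    (λ x≈ε y≈ε → trans (∙-cong x≈ε y≈ε) (identityˡ ε))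
    (λ x≈ε → trans (⁻¹-cong x≈ε) ε⁻¹≈ε)
    (λ x≈y x≈ε → trans (sym x≈y) x≈ε)

  Commute : Carrier → Carrier → Set ℓ
  Commute a b = a ∙ b ≈ b ∙ a

  Commute-resp : ∀ {a a' b b'} → a ≈ a' → b ≈ b' → Commute a b → Commute a' b'
  Commute-resp a≈a' b≈b' ab≈ba = trans (∙-cong (sym a≈a') (sym b≈b')) (trans ab≈ba (∙-cong b≈b' a≈a'))

  Commute-ε : ∀ w → Commute ε w
  Commute-ε w = trans (identityˡ w) (sym (identityʳ w))

  Commute-∙ : ∀ {u v w} → Commute u w → Commute v w → Commute (u ∙ v) w
  Commute-∙ {u} {v} {w} uw≈wu vw≈wv = begin
    u ∙ v ∙ w    ≈⟨ assoc u v w ⟩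
    u ∙ (v ∙ w)  ≈⟨ ∙-congˡ vw≈wv ⟩
    u ∙ (w ∙ v)  ≈⟨ assoc u w v ⟨
    u ∙ w ∙ v    ≈⟨ ∙-congʳ uw≈wu ⟩
    w ∙ u ∙ v    ≈⟨ assoc w u v ⟩
    w ∙ (u ∙ v)  ∎

  Commute-⁻¹ : ∀ {u w} → Commute u w → Commute (u ⁻¹) w
  Commute-⁻¹ {u} {w} uw≈wu = begin
    u ⁻¹ ∙ w                  ≈⟨ identityʳ _ ⟨
    u ⁻¹ ∙ w ∙ ε              ≈⟨ ∙-congˡ (inverseʳ u) ⟨
    u ⁻¹ ∙ w ∙ (u ∙ u ⁻¹)     ≈⟨ assoc (u ⁻¹) w _ ⟩
    u ⁻¹ ∙ (w ∙ (u ∙ u ⁻¹))   ≈⟨ ∙-congˡ (assoc w u (u ⁻¹)) ⟨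
    u ⁻¹ ∙ (w ∙ u ∙ u ⁻¹)     ≈⟨ ∙-congˡ (∙-congʳ uw≈wu) ⟨
    u ⁻¹ ∙ (u ∙ w ∙ u ⁻¹)     ≈⟨ ∙-congˡ (assoc u w (u ⁻¹)) ⟩
    u ⁻¹ ∙ (u ∙ (w ∙ u ⁻¹))   ≈⟨ assoc (u ⁻¹) u _ ⟨
    u ⁻¹ ∙ u ∙ (w ∙ u ⁻¹)     ≈⟨ ∙-congʳ (inverseˡ u) ⟩
    ε ∙ (w ∙ u ⁻¹)            ≈⟨ identityˡ _ ⟩
    w ∙ u ⁻¹                  ∎

  Gen-centralised : ∀ {S : Pred} {w} → (∀ {z} → S z → Commute z w) → ∀ {z} → Gen S z → Commute z w
  Gen-centralised {w = w} S-commute =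
    Gen-minimal (λ z → Commute z w) S-commute (Commute-ε w) Commute-∙ Commute-⁻¹
      (λ x≈y → Commute-resp x≈y refl)

  Gen-abelian : ∀ {S : Pred} → (∀ {a b} → S a → S b → Commute a b)
    → ∀ {a b} → Gen S a → Gen S b → Commute a b
  Gen-abelian S-abelian ga gb =
    Gen-centralised (λ sa → sym (Gen-centralised (λ sb → sym (S-abelian sa sb)) gb)) ga

  Commute⇒commutator≈ε : ∀ {a b} → Commute a b → [ a , b ] ≈ ε
  Commute⇒commutator≈ε {a} {b} ab≈ba = begin
    a ⁻¹ ∙ b ⁻¹ ∙ a ∙ b        ≈⟨ assoc _ a b ⟩
    a ⁻¹ ∙ b ⁻¹ ∙ (a ∙ b)      ≈⟨ ∙-congˡ ab≈ba ⟩
    a ⁻¹ ∙ b ⁻¹ ∙ (b ∙ a)      ≈⟨ assoc (a ⁻¹) (b ⁻¹) _ ⟩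
    a ⁻¹ ∙ (b ⁻¹ ∙ (b ∙ a))    ≈⟨ ∙-congˡ (assoc (b ⁻¹) b a) ⟨
    a ⁻¹ ∙ (b ⁻¹ ∙ b ∙ a)      ≈⟨ ∙-congˡ (trans (∙-congʳ (inverseˡ b)) (identityˡ a)) ⟩
    a ⁻¹ ∙ a                   ≈⟨ inverseˡ a ⟩
    ε                          ∎

  abelian⇒SolvableSub : ∀ {H : Pred} → (∀ {a b} → H a → H b → Commute a b) → SolvableSub H
  abelian⇒SolvableSub H-abelian = 1 , λ z → Gen-trivial λ where
    (a , b , ha , hb , z≈[a,b]) → trans z≈[a,b] (Commute⇒commutator≈ε (H-abelian ha hb))

  Commute⇒⟨⟩-solvable : ∀ {x y} → Commute x y → SolvableSub ⟨ x , y ⟩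
  Commute⇒⟨⟩-solvable {x} {y} xy≈yx = abelian⇒SolvableSub (Gen-abelian generators-commute)
    where
    generators-commute : ∀ {a b} → Lift c (a ≈ x ⊎ a ≈ y) → Lift c (b ≈ x ⊎ b ≈ y) → Commute a b
    generators-commute (lift (inj₁ a≈x)) (lift (inj₁ b≈x)) = Commute-resp (sym a≈x) (sym b≈x) refl
    generators-commute (lift (inj₁ a≈x)) (lift (inj₂ b≈y)) = Commute-resp (sym a≈x) (sym b≈y) xy≈yx
    generators-commute (lift (inj₂ a≈y)) (lift (inj₁ b≈x)) = Commute-resp (sym a≈y) (sym b≈x) (sym xy≈yx)
    generators-commute (lift (inj₂ a≈y)) (lift (inj₂ b≈y)) = Commute-resp (sym a≈y) (sym b≈y) refl

  Commute⇒Adj : ∀ {x y} → Commute x y → ¬ Conj x y → Adj x y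
  Commute⇒Adj {x} {y} xy≈yx x≁y = x≁y , x , y , Conj-refl x , Conj-refl y , Commute⇒⟨⟩-solvable xy≈yx
    where
    Conj-refl : ∀ a → Conj a a
    Conj-refl a = ε , sym (trans (∙-cong (identityˡ a) ε⁻¹≈ε) (identityʳ a))

  ^-commute : ∀ x m n → Commute (x ^ m) (x ^ n)
  ^-commute x m n = begin
    x ^ m ∙ x ^ n  ≈⟨ ^-homo-+ x m n ⟨
    x ^ (m + n)    ≡⟨ ≡.cong (x ^_) (+-comm m n) ⟩
    x ^ (n + m)    ≈⟨ ^-homo-+ x n m ⟩
    x ^ n ∙ x ^ m  ∎

  Commute-^ : ∀ x n → Commute x (x ^ n)
  Commute-^ x n = Commute-resp (^-identityʳ x) refl (^-commute x 1 n)

  commutingTriangle : ∀ {a b d} → IsVertex a → IsVertex b → IsVertex d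
    → Separated a b → Separated b d → Separated a d
    → Commute a b → Commute b d → Commute a d → Cycle 2
  commutingTriangle {a} {b} {d} a≉ε b≉ε d≉ε a⋈b b⋈d a⋈d ab≈ba bd≈db ad≈da = record
    { long     = s≤s (s≤s z≤n)
    ; v        = v
    ; vertex   = vertex
    ; distinct = distinct
    ; step     = λ { fzero → Commute⇒Adj ab≈ba (proj₁ a⋈b) ; (fsuc fzero) → Commute⇒Adj bd≈db (proj₁ b⋈d) }
    ; close    = Commute⇒Adj (sym ad≈da) (proj₂ a⋈d)
    }
    where
    v : Fin 3 → Carrier
    v fzero               = a
    v (fsuc fzero)        = b
    v (fsuc (fsuc fzero)) = d

    vertex : ∀ i → IsVertex (v i)
    vertex fzero               = a≉ε
    vertex (fsuc fzero)        = b≉ε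
    vertex (fsuc (fsuc fzero)) = d≉ε

    distinct : ∀ i j → ¬ i ≡ j → ¬ Conj (v i) (v j)
    distinct fzero               (fsuc fzero)        _ = proj₁ a⋈b
    distinct fzero               (fsuc (fsuc fzero)) _ = proj₁ a⋈d
    distinct (fsuc fzero)        fzero               _ = proj₂ a⋈b
    distinct (fsuc fzero)        (fsuc (fsuc fzero)) _ = proj₁ b⋈d
    distinct (fsuc (fsuc fzero)) fzero               _ = proj₂ a⋈d
    distinct (fsuc (fsuc fzero)) (fsuc fzero)        _ = proj₂ b⋈d
    distinct fzero               fzero               i≢i = ⊥-elim (i≢i ≡.refl)
    distinct (fsuc fzero)        (fsuc fzero)        i≢i = ⊥-elim (i≢i ≡.refl)
    distinct (fsuc (fsuc fzero)) (fsuc (fsuc fzero)) i≢i = ⊥-elim (i≢i ≡.refl)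

  triangle⇒girth3 : Cycle 2 → HasGirth 3 × ¬ IsTree
  triangle⇒girth3 triangle = ((2 , ≡.refl , triangle) , λ _ cycle → s≤s (Cycle.long cycle))
                           , λ tree → proj₂ tree 2 triangle

  orderPrimeProduct⇒triangle : ∀ {p q x} → Prime p → Prime q → ¬ p ≡ q → HasOrder x (p * q) → Cycle 2
  orderPrimeProduct⇒triangle {p} {q} {x} pp pq p≢q x-order@(_ , xᵖᑫ≈ε , minimal) =
    commutingTriangle xᵖ≉ε xᑫ≉ε x≉ε
      (annihilator⇒Separated q xᵖ^q≈ε xᑫ^q≉ε)
      (annihilator⇒Separated p xᑫ^p≈ε xᵖ≉ε)
      (annihilator⇒Separated q xᵖ^q≈ε xᑫ≉ε)
      (^-commute x p q) (sym (Commute-^ x q)) (sym (Commute-^ x p))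
    where
    instance
      p≢0 : NonZero p
      p≢0 = prime⇒nonZero pp
      q≢0 : NonZero q
      q≢0 = prime⇒nonZero pq
    1<p : 1 < p
    1<p = nonTrivial⇒n>1 p {{prime⇒nonTrivial pp}}
    1<q : 1 < q
    1<q = nonTrivial⇒n>1 q {{prime⇒nonTrivial pq}}
    p<pq : p < p * q
    p<pq = m<m*n p q 1<q
    q<pq : q < p * q
    q<pq = ≡.subst (q <_) (*-comm q p) (m<m*n q p 1<p)

    x≉ε : ¬ x ≈ ε
    x≉ε x≈ε = minimal 1 (s≤s z≤n) (<-trans 1<p p<pq) (trans (^-identityʳ x) x≈ε)
    xᵖ≉ε : ¬ x ^ p ≈ ε
    xᵖ≉ε = minimal p (<-trans (s≤s z≤n) 1<p) p<pq
    xᑫ≉ε : ¬ x ^ q ≈ ε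
    xᑫ≉ε = minimal q (<-trans (s≤s z≤n) 1<q) q<pq

    xᵖ^q≈ε : (x ^ p) ^ q ≈ ε
    xᵖ^q≈ε = trans (^-assoc x p q) (trans (reflexive (≡.cong (x ^_) (*-comm q p))) xᵖᑫ≈ε)
    xᑫ^p≈ε : (x ^ q) ^ p ≈ ε
    xᑫ^p≈ε = trans (^-assoc x q p) xᵖᑫ≈ε
    xᑫ^q≉ε : ¬ (x ^ q) ^ q ≈ ε
    xᑫ^q≉ε xᑫᑫ≈ε = distinctPrimes⇒¬p*q∣q*q pp pq p≢q (order∣ x-order (trans (sym (^-assoc x q q)) xᑫᑫ≈ε))

mainTheorem3 : ∀ {c ℓ : Level} (G : Group c ℓ) (p q : ℕ) → Prime p → Prime q → ¬ (p ≡ q)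
    → ¬ GroupTheory.Solvable G
    → (∃ λ x → GroupTheory.HasOrder G x (p * q))
    → GroupTheory.HasGirth G 3 × ¬ GroupTheory.IsTree G
mainTheorem3 G p q pp pq p≢q _ (x , x-order) =
  triangle⇒girth3 (orderPrimeProduct⇒triangle pp pq p≢q x-order)
  where open GroupProperties G
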